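{- Let $k,m\ge1$, and let $\phi$ act on $k$-tilings of the Aztec diamond of rank $m$ by reflecting each of the $k$ tilings across the line $y=x$. If $\mathbf T$ is a $k$-tiling with $j$ interactions, then $\phi(\mathbf T)$ is a $k$-tiling with $\binom{k}{2}\binom{m+1}{2}-j$ interactions. This holds for either of the two notions of interaction described in the context.
   Context: The Aztec diamond of rank $m$ is the union of the closed unit squares $[a,a+1]\times[b,b+1]$ ($a,b\in\mathbb Z$) contained in $\{|x|+|y|\le m+1\}$; a square is gray if $a+b+m$ is even and white otherwise (the reflection across $y=x$ preserves the diamond and the coloring). A $k$-tiling is a $k$-tuple $(T_1,\dots,T_k)$ of domino tilings, $T_c$ of color $c$. Notion 1: for a tiling $T$ and a gray square $g$, let $d_T(g)\in\{N,E,S,W\}$ be the direction from $g$ to the white square covered together with $g$; for colors $\alpha<\beta$, $(\alpha,\beta,g)$ is an interaction if $(d_{T_\alpha}(g),d_{T_\beta}(g))\in\{(N,W),(S,S),(W,S),(N,S)\}$. Notion 2: for a tiling $T$ and a white square $w$, let $e_T(w)\in\{N,E,S,W\}$ be the direction from $w$ to the gray square covered together with $w$; for colors $\alpha<\beta$, $(\alpha,\beta,w)$ is an interaction if $(e_{T_\alpha}(w),e_{T_\beta}(w))\in\{(E,N),(E,E),(N,W),(E,W)\}$. The number of interactions of $\mathbf T$ is the number of such triples. -}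

module Defs where

open import Data.Bool using (Bool; true; false; _∧_; if_then_else_; not)
open import Data.Nat using (ℕ; zero; suc; _<ᵇ_; _≤ᵇ_; _≡ᵇ_; _%_)
  renaming (_+_ to _+ℕ_; _*_ to _*ℕ_)
open import Data.Integer using (ℤ; +_; _+_; _-_; ∣_∣)
open import Data.Integer.Properties using (+-comm)
open import Data.Nat.Properties using () renaming (+-comm to +ℕ-comm)
open import Data.Fin using (Fin; toℕ)
open import Data.List using (List; map; upTo; allFin; concatMap; filter; length)
open import Data.Nat.ListAction using (sum)
open import Data.Product using (_×_; _,_; proj₁; proj₂)
open import Relation.Binary.PropositionalEquality using (_≡_; refl; cong; subst; trans; sym)

-- Squares of the plane: the square [a,a+1]×[b,b+1] is named by (a , b).

Square : Set
Square = ℤ × ℤ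

data Dir : Set where
  N E S W : Dir

step : Square → Dir → Square
step (a , b) N = (a , b + + 1)
step (a , b) S = (a , b - + 1)
step (a , b) E = (a + + 1 , b)
step (a , b) W = (a - + 1 , b)

opp : Dir → Dir
opp N = S
opp S = N
opp E = W
opp W = E

inRegion : ℕ → ℤ → ℤ → Bool
inRegion m x y = (∣ x ∣ +ℕ ∣ y ∣) ≤ᵇ suc m

-- The closed square (a,b) is contained in { |x|+|y| ≤ m+1 }
-- iff its four corners are (the region is convex).
inDiamond : ℕ → Square → Bool
inDiamond m (a , b) =
  inRegion m a b ∧ inRegion m (a + + 1) b ∧
  inRegion m a (b + + 1) ∧ inRegion m (a + + 1) (b + + 1)

InDiamond : ℕ → Square → Set
InDiamond m s = inDiamond m s ≡ true

gray : ℕ → Square → Bool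
gray m (a , b) = ∣ a + b + + m ∣ % 2 ≡ᵇ 0

white : ℕ → Square → Bool
white m s = not (gray m s)

-- Domino tilings of the Aztec diamond of rank m, encoded as the
-- perfect matching of adjacent squares they induce: each square s of
-- the diamond is covered together with its neighbour in direction
-- dir s; that neighbour lies in the diamond and is covered with s.

record Tiling (m : ℕ) : Set where
  field
    dir        : Square → Dir
    inside     : ∀ s → InDiamond m s → InDiamond m (step s (dir s))
    involutive : ∀ s → InDiamond m s → dir (step s (dir s)) ≡ opp (dir s)
open Tiling public

KTiling : ℕ → ℕ → Set
KTiling k m = Fin k → Tiling m

swapSq : Square → Square
swapSq (a , b) = (b , a)

swapDir : Dir → Dir
swapDir N = E
swapDir E = N
swapDir S = W
swapDir W = S

step-swap : ∀ s d → step (swapSq s) (swapDir d) ≡ swapSq (step s d)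
step-swap (a , b) N = refl
step-swap (a , b) E = refl
step-swap (a , b) S = refl
step-swap (a , b) W = refl

swapDir-opp : ∀ d → swapDir (opp d) ≡ opp (swapDir d)
swapDir-opp N = refl
swapDir-opp E = refl
swapDir-opp S = refl
swapDir-opp W = refl

swapDir-inv : ∀ d → swapDir (swapDir d) ≡ d
swapDir-inv N = refl
swapDir-inv E = refl
swapDir-inv S = refl
swapDir-inv W = refl

inRegion-comm : ∀ m x y → inRegion m x y ≡ inRegion m y x
inRegion-comm m x y = cong (λ n → n ≤ᵇ suc m) (+ℕ-comm ∣ x ∣ ∣ y ∣)

private
  ∧-swap : ∀ p q r s → (p ∧ q ∧ r ∧ s) ≡ (p ∧ r ∧ q ∧ s)
  ∧-swap true q r s = go q r s
    where
    go : ∀ q r s → (q ∧ r ∧ s) ≡ (r ∧ q ∧ s)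
    go true true s = refl
    go true false s = refl
    go false true s = refl
    go false false s = refl
  ∧-swap false q r s = refl

inDiamond-swap : ∀ m s → inDiamond m (swapSq s) ≡ inDiamond m s
inDiamond-swap m (a , b)
  rewrite inRegion-comm m b a
        | inRegion-comm m (b + + 1) a
        | inRegion-comm m b (a + + 1)
        | inRegion-comm m (b + + 1) (a + + 1)
  = ∧-swap (inRegion m a b) (inRegion m a (b + + 1))
           (inRegion m (a + + 1) b) (inRegion m (a + + 1) (b + + 1))

swapSq-inv : ∀ s → swapSq (swapSq s) ≡ s
swapSq-inv (a , b) = refl

reflInside : ∀ {m} (T : Tiling m) (s : Square) → InDiamond m s →
  InDiamond m (step s (swapDir (dir T (swapSq s))))
reflInside {m} T (a , b) p =
  subst (λ t → InDiamond m t) (sym (step-swap (b , a) (dir T (b , a))))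
    (trans (inDiamond-swap m (step (b , a) (dir T (b , a))))
           (inside T (b , a) (trans (inDiamond-swap m (a , b)) p)))

reflInvol : ∀ {m} (T : Tiling m) (s : Square) → InDiamond m s →
  swapDir (dir T (swapSq (step s (swapDir (dir T (swapSq s))))))
    ≡ opp (swapDir (dir T (swapSq s)))
reflInvol {m} T (a , b) p =
  trans (cong (λ u → swapDir (dir T (swapSq u))) (step-swap (b , a) (dir T (b , a))))
    (trans (cong (λ u → swapDir (dir T u)) (swapSq-inv (step (b , a) (dir T (b , a)))))
      (trans (cong swapDir (involutive T (b , a) (trans (inDiamond-swap m (a , b)) p)))
             (swapDir-opp (dir T (b , a)))))

reflectTiling : ∀ {m} → Tiling m → Tiling m
reflectTiling {m} T = record
  { dir = λ s → swapDir (dir T (swapSq s))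
  ; inside = reflInside T
  ; involutive = reflInvol T
  }

φ : ∀ {k m} → KTiling k m → KTiling k m
φ T c = reflectTiling (T c)

-- All squares (a,b) with -(m+1) ≤ a,b ≤ m; every square of the
-- Aztec diamond of rank m is among them.
coords : ℕ → List ℤ
coords m = map (λ i → + i - + (suc m)) (upTo (2 *ℕ suc m))

diamondSquares : ℕ → List Square
diamondSquares m =
  filter (λ s → inDiamond m s ≟b true)
    (concatMap (λ a → map (λ b → (a , b)) (coords m)) (coords m))
  where
  open import Data.Bool.Properties using () renaming (_≟_ to _≟b_)

grayCells : ℕ → List Square
grayCells m = filter (λ s → gray m s ≟b true) (diamondSquares m)
  where open import Data.Bool.Properties using () renaming (_≟_ to _≟b_)

whiteCells : ℕ → List Square
whiteCells m = filter (λ s → white m s ≟b true) (diamondSquares m)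
  where open import Data.Bool.Properties using () renaming (_≟_ to _≟b_)

colourPairs : (k : ℕ) → List (Fin k × Fin k)
colourPairs k =
  filter (λ p → (toℕ (proj₁ p) <ᵇ toℕ (proj₂ p)) ≟b true)
    (concatMap (λ α → map (λ β → (α , β)) (allFin k)) (allFin k))
  where open import Data.Bool.Properties using () renaming (_≟_ to _≟b_)

rel₁ : Dir → Dir → Bool
rel₁ N W = true
rel₁ S S = true
rel₁ W S = true
rel₁ N S = true
rel₁ _ _ = false

rel₂ : Dir → Dir → Bool
rel₂ E N = true
rel₂ E E = true
rel₂ N W = true
rel₂ E W = true
rel₂ _ _ = false

indicator : Bool → ℕ
indicator true = 1
indicator false = 0

interactions₁ : ∀ {k m} → KTiling k m → ℕ
interactions₁ {k} {m} T =
  sum (concatMap (λ p → map (λ g → indicator (rel₁ (dir (T (proj₁ p)) g) (dir (T (proj₂ p)) g)))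
                             (grayCells m))
                 (colourPairs k))

interactions₂ : ∀ {k m} → KTiling k m → ℕ
interactions₂ {k} {m} T =
  sum (concatMap (λ p → map (λ w → indicator (rel₂ (dir (T (proj₁ p)) w) (dir (T (proj₂ p)) w)))
                             (whiteCells m))
                 (colourPairs k))

{-# OPTIONS --safe #-}
-- Reflection across y = x keeps the colour of every square and swaps N ↔ E and
-- S ↔ W.  Checking the sixteen pairs of directions shows that, for colours α < β,
-- the interactions of T at a gray square g and of φ(T) at its mirror image
-- together number 1 if d_β(g) ∈ {S, W} and 0 otherwise (notion 1); for notion 2
-- the condition is e_α(w) ∈ {N, E}, i.e. d_α ∈ {S, W} at the gray partner of w.
-- So for each pair of colours the two counts add up to the number of dominoes
-- pointing S or W from their gray square, and this number is the same for every
-- tiling.  Indeed as many dominoes point N as S: summing the row index over the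
-- gray squares and over their partners gives the same total, since the partners
-- are exactly the white squares, the mirror image under x ↦ -x of the gray ones.
-- As many point E as W by the same argument for the reflected tiling.  Hence the
-- number is half the number of gray squares, a quarter of the 2m(m+1) squares of
-- the diamond, that is (m+1 choose 2).
module Submission where

open import Algebra.Bundles using (AbelianGroup)
open import Data.Bool using (Bool; true; false; not; _∧_; _xor_; T)
open import Data.Bool.Properties
  using (not-involutive; ∧-comm; ∧-assoc; ∧-conicalˡ; ∧-conicalʳ;
         xor-same; xor-identityʳ; not-distribʳ-xor)
  renaming (_≟_ to _≟ᵇ_)
open import Data.Fin using (Fin; toℕ)
open import Data.Integer as ℤ using (ℤ; -[1+_]; ∣_∣) renaming (+_ to pos)
import Data.Integer.Properties as ℤₚ
open import Data.Integer.Tactic.RingSolver renaming (solve-∀ to solveℤ)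
open import Data.List
  using (List; []; _∷_; _++_; _∷ʳ_; foldr; map; filter; length; concatMap;
         cartesianProduct; tabulate; allFin; upTo)
open import Data.List.Properties
  using (map-++; map-∘; map-cong; map-cong-local; map-id-local; map-tabulate;
         map-concatMap; length-map; upTo-∷ʳ)
open import Data.List.Membership.Propositional using (_∈_)
open import Data.List.Membership.Propositional.Properties
  using (∈-map⁺; ∈-map⁻; ∈-upTo⁺; ∈-filter⁺; ∈-filter⁻; ∈-cartesianProduct⁺)
open import Data.List.Membership.Propositional.Properties.WithK using (unique∧set⇒bag)
import Data.List.Relation.Unary.All as All
open import Data.List.Relation.Unary.Unique.Propositional using (Unique)
import Data.List.Relation.Unary.Unique.Propositional.Properties as Unique
open import Data.List.Relation.Binary.Permutation.Propositional using (_↭_; ↭⇒↭ₛ)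
import Data.List.Relation.Binary.Permutation.Propositional.Properties as ↭
open import Data.List.Relation.Binary.Permutation.Setoid.Properties using (foldr-commMonoid)
open import Data.List.Relation.Binary.BagAndSetEquality using (∼bag⇒↭)
open import Data.Nat
  using (ℕ; zero; suc; _+_; _*_; _∸_; _⊓_; _⊔_; _≤_; _<_; _<ᵇ_; _≤ᵇ_; _%_; _≡ᵇ_; s≤s)
open import Data.Nat.Properties
open import Data.Nat.Combinatorics using (_C_; nC1≡n; nCk+nC[k+1]≡[n+1]C[k+1])
open import Data.Nat.ListAction using (sum)
open import Data.Nat.ListAction.Properties using (sum-++; sum-↭)
open import Data.Nat.Tactic.RingSolver using (solve-∀)
open import Data.Product using (_×_; _,_; proj₁; proj₂)
open import Function using (_∘_)
open import Function.Bundles using (mk⇔)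
open import Relation.Binary.PropositionalEquality
  using (_≡_; refl; sym; trans; cong; cong₂; subst; setoid; module ≡-Reasoning)
open import Relation.Nullary using (contradiction; ofʸ; ofⁿ)

open import Algebra.Properties.CommutativeSemigroup +-commutativeSemigroup using (interchange)
open import Algebra.Properties.CommutativeSemigroup ℤₚ.+-commutativeSemigroup
  using () renaming (interchange to interchangeℤ)
open import Algebra.Properties.Group (AbelianGroup.group ℤₚ.+-0-abelianGroup)
  using (//-rightDividesˡ; //-rightDividesʳ) renaming (∙-cancelˡ to +-cancelˡ; ∙-cancelʳ to +-cancelʳ)

open import Defs

private
  variable
    A B : Set

sum-map-+ : (f g : A → ℕ) (xs : List A) →
  sum (map (λ x → f x + g x) xs) ≡ sum (map f xs) + sum (map g xs)
sum-map-+ f g [] = refl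
sum-map-+ f g (x ∷ xs) rewrite sum-map-+ f g xs = interchange (f x) (g x) _ _

sum-map-cong : {f g : A → ℕ} (xs : List A) → (∀ {x} → x ∈ xs → f x ≡ g x) →
  sum (map f xs) ≡ sum (map g xs)
sum-map-cong xs f≗g = cong sum (map-cong-local (All.tabulate f≗g))

sum-map-const : (c : ℕ) (xs : List A) → sum (map (λ _ → c) xs) ≡ length xs * c
sum-map-const c [] = refl
sum-map-const c (x ∷ xs) = cong (c +_) (sum-map-const c xs)

sum-concatMap : (f : A → List ℕ) (xs : List A) →
  sum (concatMap f xs) ≡ sum (map (sum ∘ f) xs)
sum-concatMap f [] = refl
sum-concatMap f (x ∷ xs) =
  trans (sum-++ (f x) (concatMap f xs)) (cong (sum (f x) +_) (sum-concatMap f xs))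

length-filter-true : (f : A → Bool) (xs : List A) →
  length (filter (λ x → f x ≟ᵇ true) xs) ≡ sum (map (indicator ∘ f) xs)
length-filter-true f [] = refl
length-filter-true f (x ∷ xs) with f x
... | true = cong suc (length-filter-true f xs)
... | false = length-filter-true f xs

sum-map-∘-↭ : (F : B → ℕ) {f : A → B} {xs : List A} {ys : List B} →
  map f xs ↭ ys → sum (map (F ∘ f) xs) ≡ sum (map F ys)
sum-map-∘-↭ F {xs = xs} fxs↭ys = trans (cong sum (map-∘ xs)) (sum-↭ (↭.map⁺ F fxs↭ys))

sumℤ : List ℤ → ℤ
sumℤ = foldr ℤ._+_ (pos 0)

sumℤ-map-∘-↭ : (F : B → ℤ) {f : A → B} {xs : List A} {ys : List B} →
  map f xs ↭ ys → sumℤ (map (F ∘ f) xs) ≡ sumℤ (map F ys)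
sumℤ-map-∘-↭ F {xs = xs} fxs↭ys = trans (cong sumℤ (map-∘ xs))
  (foldr-commMonoid (setoid ℤ) ℤₚ.+-0-isCommutativeMonoid (↭⇒↭ₛ (↭.map⁺ F fxs↭ys)))

sumℤ-map-+ : (f g : A → ℤ) (xs : List A) →
  sumℤ (map (λ x → f x ℤ.+ g x) xs) ≡ sumℤ (map f xs) ℤ.+ sumℤ (map g xs)
sumℤ-map-+ f g [] = refl
sumℤ-map-+ f g (x ∷ xs) rewrite sumℤ-map-+ f g xs = interchangeℤ (f x) (g x) _ _

sumℤ-map-pos : (f : A → ℕ) (xs : List A) → sumℤ (map (pos ∘ f) xs) ≡ pos (sum (map f xs))
sumℤ-map-pos f [] = refl
sumℤ-map-pos f (x ∷ xs) = cong (λ t → pos (f x) ℤ.+ t) (sumℤ-map-pos f xs)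

map-↭-inverse : {f g : A → A} {xs ys : List A} → Unique xs → Unique ys →
  (∀ {x} → x ∈ xs → f x ∈ ys) → (∀ {y} → y ∈ ys → g y ∈ xs) →
  (∀ {x} → x ∈ xs → g (f x) ≡ x) → (∀ {y} → y ∈ ys → f (g y) ≡ y) →
  map f xs ↭ ys
map-↭-inverse {f = f} {g} {xs} xs! ys! f∈ g∈ gf≡id fg≡id =
  ∼bag⇒↭ (unique∧set⇒bag fxs! ys! (mk⇔ to from))
  where
  g∘f∘xs≡xs : map g (map f xs) ≡ xs
  g∘f∘xs≡xs = trans (sym (map-∘ xs)) (map-id-local (All.tabulate gf≡id))
  fxs! : Unique (map f xs)
  fxs! = Unique.map⁻ {f = g} (subst Unique (sym g∘f∘xs≡xs) xs!)
  to : ∀ {z} → z ∈ map f xs → z ∈ _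
  to z∈ with _ , x∈ , refl ← ∈-map⁻ f z∈ = f∈ x∈
  from : ∀ {z} → z ∈ _ → z ∈ map f xs
  from z∈ = subst (_∈ map f xs) (fg≡id z∈) (∈-map⁺ f (g∈ z∈))

Σ< : ℕ → (ℕ → ℕ) → ℕ
Σ< zero f = 0
Σ< (suc n) f = Σ< n f + f n

sum-map-upTo : (f : ℕ → ℕ) (n : ℕ) → sum (map f (upTo n)) ≡ Σ< n f
sum-map-upTo f zero = refl
sum-map-upTo f (suc n) = begin
  sum (map f (upTo (suc n)))         ≡⟨ cong (sum ∘ map f) (upTo-∷ʳ n) ⟨
  sum (map f (upTo n ∷ʳ n))          ≡⟨ cong sum (map-++ f (upTo n) (n ∷ [])) ⟩
  sum (map f (upTo n) ++ (f n ∷ [])) ≡⟨ sum-++ (map f (upTo n)) (f n ∷ []) ⟩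
  sum (map f (upTo n)) + (f n + 0)   ≡⟨ cong₂ _+_ (sum-map-upTo f n) (+-identityʳ (f n)) ⟩
  Σ< n f + f n                       ∎
  where open ≡-Reasoning

Σ<-suc : (n : ℕ) (f : ℕ → ℕ) → Σ< (suc n) f ≡ f 0 + Σ< n (f ∘ suc)
Σ<-suc zero f = +-comm 0 (f 0)
Σ<-suc (suc n) f rewrite Σ<-suc n f = +-assoc (f 0) _ _

sum-map-allFin : (f : ℕ → ℕ) (k : ℕ) → sum (map (f ∘ toℕ) (allFin k)) ≡ Σ< k f
sum-map-allFin f k = trans (cong sum (map-tabulate {n = k} (λ i → i) (f ∘ toℕ))) (sum-tabulate f k)
  where
  sum-tabulate : (f : ℕ → ℕ) (k : ℕ) → sum (tabulate {n = k} (f ∘ toℕ)) ≡ Σ< k f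
  sum-tabulate f zero = refl
  sum-tabulate f (suc k) = trans (cong (f 0 +_) (sum-tabulate (f ∘ suc) k)) (sym (Σ<-suc k f))

Σ<-cong : (n : ℕ) {f g : ℕ → ℕ} → (∀ {i} → i < n → f i ≡ g i) → Σ< n f ≡ Σ< n g
Σ<-cong zero f≗g = refl
Σ<-cong (suc n) f≗g = cong₂ _+_ (Σ<-cong n (f≗g ∘ m<n⇒m<1+n)) (f≗g ≤-refl)

Σ<-+ : (n : ℕ) (f g : ℕ → ℕ) → Σ< n (λ i → f i + g i) ≡ Σ< n f + Σ< n g
Σ<-+ zero f g = refl
Σ<-+ (suc n) f g rewrite Σ<-+ n f g = interchange (Σ< n f) (Σ< n g) (f n) (g n)

Σ<-++ : (a b : ℕ) (f : ℕ → ℕ) → Σ< (a + b) f ≡ Σ< a f + Σ< b (λ l → f (a + l))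
Σ<-++ a zero f rewrite +-identityʳ a = sym (+-identityʳ _)
Σ<-++ a (suc b) f rewrite +-suc a b | Σ<-++ a b f = +-assoc (Σ< a f) _ _

Σ<-reverse : (n : ℕ) (f : ℕ → ℕ) → Σ< n (λ l → f (n ∸ suc l)) ≡ Σ< n f
Σ<-reverse zero f = refl
Σ<-reverse (suc n) f = begin
  Σ< (suc n) (λ l → f (n ∸ l))     ≡⟨ Σ<-suc n (λ l → f (n ∸ l)) ⟩
  f n + Σ< n (λ l → f (n ∸ suc l)) ≡⟨ cong (f n +_) (Σ<-reverse n f) ⟩
  f n + Σ< n f                     ≡⟨ +-comm (f n) _ ⟩
  Σ< (suc n) f                     ∎
  where open ≡-Reasoning

Σ<-id : (n : ℕ) → Σ< n (λ i → i) ≡ n C 2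
Σ<-id zero = refl
Σ<-id (suc n) = begin
  Σ< n (λ i → i) + n ≡⟨ cong₂ _+_ (Σ<-id n) (sym (nC1≡n n)) ⟩
  n C 2 + n C 1      ≡⟨ +-comm (n C 2) (n C 1) ⟩
  n C 1 + n C 2      ≡⟨ nCk+nC[k+1]≡[n+1]C[k+1] n 1 ⟩
  suc n C 2          ∎
  where open ≡-Reasoning

Σ<[n∸1+i]≡nC2 : (n : ℕ) → Σ< n (λ i → n ∸ suc i) ≡ n C 2
Σ<[n∸1+i]≡nC2 n = trans (Σ<-reverse n (λ i → i)) (Σ<-id n)

Σ<-count-< : (a k : ℕ) → Σ< k (λ b → indicator (a <ᵇ b)) ≡ k ∸ suc a
Σ<-count-< a zero = refl
Σ<-count-< a (suc k) with a <ᵇ k in a<ᵇk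
... | true = begin
  Σ< k (λ b → indicator (a <ᵇ b)) + 1 ≡⟨ cong (_+ 1) (Σ<-count-< a k) ⟩
  k ∸ suc a + 1                       ≡⟨ +-comm (k ∸ suc a) 1 ⟩
  suc (k ∸ suc a)                     ≡⟨ +-∸-assoc 1 (<ᵇ⇒< a k (subst T (sym a<ᵇk) _)) ⟨
  suc k ∸ suc a                       ∎
  where open ≡-Reasoning
... | false = begin
  Σ< k (λ b → indicator (a <ᵇ b)) + 0 ≡⟨ +-identityʳ _ ⟩
  Σ< k (λ b → indicator (a <ᵇ b))     ≡⟨ Σ<-count-< a k ⟩
  k ∸ suc a                           ≡⟨ m≤n⇒m∸n≡0 (m≤n⇒m≤1+n k≤a) ⟩
  0                                   ≡⟨ m≤n⇒m∸n≡0 (s≤s k≤a) ⟨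
  suc k ∸ suc a                       ∎
  where
  open ≡-Reasoning
  k≤a : k ≤ a
  k≤a = ≮⇒≥ (λ a<k → subst T a<ᵇk (<⇒<ᵇ a<k))

Σ<-count-≤ : (n e K : ℕ) → Σ< n (λ l → indicator (e + suc l ≤ᵇ K)) ≡ n ⊓ (K ∸ e)
Σ<-count-≤ zero e K = refl
Σ<-count-≤ (suc n) e K with e + suc n ≤ᵇ K in e+1+n≤ᵇK
... | true = begin
  Σ< n (λ l → indicator (e + suc l ≤ᵇ K)) + 1 ≡⟨ cong (_+ 1) (Σ<-count-≤ n e K) ⟩
  n ⊓ (K ∸ e) + 1                             ≡⟨ cong (_+ 1) (m≤n⇒m⊓n≡m (<⇒≤ n<K∸e)) ⟩
  n + 1                                       ≡⟨ +-comm n 1 ⟩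
  suc n                                       ≡⟨ m≤n⇒m⊓n≡m n<K∸e ⟨
  suc n ⊓ (K ∸ e)                             ∎
  where
  open ≡-Reasoning
  e+1+n≤K : e + suc n ≤ K
  e+1+n≤K = ≤ᵇ⇒≤ (e + suc n) K (subst T (sym e+1+n≤ᵇK) _)
  n<K∸e : n < K ∸ e
  n<K∸e = m+n≤o⇒m≤o∸n (suc n) (subst (_≤ K) (+-comm e (suc n)) e+1+n≤K)
... | false = begin
  Σ< n (λ l → indicator (e + suc l ≤ᵇ K)) + 0 ≡⟨ +-identityʳ _ ⟩
  Σ< n (λ l → indicator (e + suc l ≤ᵇ K))     ≡⟨ Σ<-count-≤ n e K ⟩
  n ⊓ (K ∸ e)                                 ≡⟨ m≥n⇒m⊓n≡n K∸e≤n ⟩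
  K ∸ e                                       ≡⟨ m≥n⇒m⊓n≡n (m≤n⇒m≤1+n K∸e≤n) ⟨
  suc n ⊓ (K ∸ e)                             ∎
  where
  open ≡-Reasoning
  K≤e+n : K ≤ e + n
  K≤e+n = ≮⇒≥ (λ e+n<K → subst T e+1+n≤ᵇK (≤⇒≤ᵇ (subst (_≤ K) (sym (+-suc e n)) e+n<K)))
  K∸e≤n : K ∸ e ≤ n
  K∸e≤n = m≤n+o⇒m∸n≤o K e K≤e+n

⊔-≤ᵇ : (x y K : ℕ) → (x ⊔ y ≤ᵇ K) ≡ (x ≤ᵇ K) ∧ (y ≤ᵇ K)
⊔-≤ᵇ x y K
  with x ⊔ y ≤ᵇ K | ≤ᵇ-reflects-≤ (x ⊔ y) K | x ≤ᵇ K | ≤ᵇ-reflects-≤ x K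
     | y ≤ᵇ K | ≤ᵇ-reflects-≤ y K
... | true  | _         | true  | _       | true  | _       = refl
... | true  | ofʸ x⊔y≤K | false | ofⁿ x≰K | _     | _       =
  contradiction (≤-trans (m≤m⊔n x y) x⊔y≤K) x≰K
... | true  | ofʸ x⊔y≤K | true  | _       | false | ofⁿ y≰K =
  contradiction (≤-trans (m≤n⊔m x y) x⊔y≤K) y≰K
... | false | ofⁿ x⊔y≰K | true  | ofʸ x≤K | true  | ofʸ y≤K =
  contradiction (⊔-lub x≤K y≤K) x⊔y≰K
... | false | _         | true  | _       | false | _       = refl
... | false | _         | false | _       | _     | _       = refl

⊔+⊔-≤ᵇ : (a b c d K : ℕ) →
  ((a ⊔ b) + (c ⊔ d) ≤ᵇ K) ≡ (a + c ≤ᵇ K) ∧ (b + c ≤ᵇ K) ∧ (a + d ≤ᵇ K) ∧ (b + d ≤ᵇ K)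
⊔+⊔-≤ᵇ a b c d K = begin
  ((a ⊔ b) + (c ⊔ d) ≤ᵇ K)                ≡⟨ cong (_≤ᵇ K) (+-distribˡ-⊔ (a ⊔ b) c d) ⟩
  ((a ⊔ b) + c) ⊔ ((a ⊔ b) + d) ≤ᵇ K      ≡⟨ ⊔-≤ᵇ ((a ⊔ b) + c) ((a ⊔ b) + d) K ⟩
  ((a ⊔ b) + c ≤ᵇ K) ∧ ((a ⊔ b) + d ≤ᵇ K) ≡⟨ cong₂ _∧_ (split c) (split d) ⟩
  ((a + c ≤ᵇ K) ∧ (b + c ≤ᵇ K)) ∧ ((a + d ≤ᵇ K) ∧ (b + d ≤ᵇ K))
                                          ≡⟨ ∧-assoc (a + c ≤ᵇ K) _ _ ⟩
  (a + c ≤ᵇ K) ∧ (b + c ≤ᵇ K) ∧ (a + d ≤ᵇ K) ∧ (b + d ≤ᵇ K) ∎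
  where
  open ≡-Reasoning
  split : ∀ e → ((a ⊔ b) + e ≤ᵇ K) ≡ (a + e ≤ᵇ K) ∧ (b + e ≤ᵇ K)
  split e = trans (cong (_≤ᵇ K) (+-distribʳ-⊔ e a b)) (⊔-≤ᵇ (a + e) (b + e) K)

odd : ℕ → Bool
odd zero = false
odd (suc n) = not (odd n)

[n%2≡ᵇ0]≡not-odd : (n : ℕ) → (n % 2 ≡ᵇ 0) ≡ not (odd n)
[n%2≡ᵇ0]≡not-odd zero = refl
[n%2≡ᵇ0]≡not-odd (suc zero) = refl
[n%2≡ᵇ0]≡not-odd (suc (suc n)) =
  trans ([n%2≡ᵇ0]≡not-odd n) (sym (not-involutive (not (odd n))))

oddℤ : ℤ → Bool
oddℤ x = odd ∣ x ∣

oddℤ-neg : (x : ℤ) → oddℤ (ℤ.- x) ≡ oddℤ x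
oddℤ-neg x = cong odd (ℤₚ.∣-i∣≡∣i∣ x)

oddℤ-suc : (x : ℤ) → oddℤ (ℤ.suc x) ≡ not (oddℤ x)
oddℤ-suc (pos n) = refl
oddℤ-suc -[1+ zero ] = refl
oddℤ-suc -[1+ suc n ] = sym (not-involutive (odd (suc n)))

oddℤ-+-pos : (x : ℤ) (n : ℕ) → oddℤ (x ℤ.+ pos n) ≡ oddℤ x xor odd n
oddℤ-+-pos x zero = trans (cong oddℤ (ℤₚ.+-identityʳ x)) (sym (xor-identityʳ (oddℤ x)))
oddℤ-+-pos x (suc n) = begin
  oddℤ (x ℤ.+ pos (suc n))   ≡⟨ cong oddℤ (trans (ℤₚ.+-comm x _) (ℤₚ.+-assoc (pos 1) (pos n) x)) ⟩
  oddℤ (ℤ.suc (pos n ℤ.+ x)) ≡⟨ oddℤ-suc (pos n ℤ.+ x) ⟩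
  not (oddℤ (pos n ℤ.+ x))   ≡⟨ cong (not ∘ oddℤ) (ℤₚ.+-comm (pos n) x) ⟩
  not (oddℤ (x ℤ.+ pos n))   ≡⟨ cong not (oddℤ-+-pos x n) ⟩
  not (oddℤ x xor odd n)     ≡⟨ not-distribʳ-xor (oddℤ x) (odd n) ⟩
  oddℤ x xor odd (suc n)     ∎
  where open ≡-Reasoning

oddℤ-+ : (x y : ℤ) → oddℤ (x ℤ.+ y) ≡ oddℤ x xor oddℤ y
oddℤ-+ x (pos n) = oddℤ-+-pos x n
oddℤ-+ x y@(-[1+ n ]) = begin
  oddℤ (x ℤ.+ y)          ≡⟨ oddℤ-neg (x ℤ.+ y) ⟨
  oddℤ (ℤ.- (x ℤ.+ y))    ≡⟨ cong oddℤ (ℤₚ.neg-distrib-+ x y) ⟩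
  oddℤ (ℤ.- x ℤ.+ ℤ.- y)  ≡⟨ oddℤ-+-pos (ℤ.- x) (suc n) ⟩
  oddℤ (ℤ.- x) xor oddℤ y ≡⟨ cong (_xor oddℤ y) (oddℤ-neg x) ⟩
  oddℤ x xor oddℤ y       ∎
  where open ≡-Reasoning

-- Colours and symmetries of squares

colourIndex : ℕ → Square → ℤ
colourIndex m (a , b) = a ℤ.+ b ℤ.+ pos m

gray≡not-oddℤ : (m : ℕ) (s : Square) → gray m s ≡ not (oddℤ (colourIndex m s))
gray≡not-oddℤ m (a , b) = [n%2≡ᵇ0]≡not-odd ∣ a ℤ.+ b ℤ.+ pos m ∣

gray-odd-shift : (m : ℕ) (s t : Square) (δ : ℤ) → oddℤ δ ≡ true →
  colourIndex m t ≡ δ ℤ.+ colourIndex m s → gray m t ≡ not (gray m s)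
gray-odd-shift m s t δ δ-odd t≡δ+s = begin
  gray m t                                ≡⟨ gray≡not-oddℤ m t ⟩
  not (oddℤ (colourIndex m t))            ≡⟨ cong (not ∘ oddℤ) t≡δ+s ⟩
  not (oddℤ (δ ℤ.+ colourIndex m s))      ≡⟨ cong not (oddℤ-+ δ (colourIndex m s)) ⟩
  not (oddℤ δ xor oddℤ (colourIndex m s)) ≡⟨ cong (λ b → not (b xor _)) δ-odd ⟩
  not (not (oddℤ (colourIndex m s)))      ≡⟨ cong not (gray≡not-oddℤ m s) ⟨
  not (gray m s)                          ∎
  where open ≡-Reasoning

gray-step : (m : ℕ) (s : Square) (d : Dir) → gray m (step s d) ≡ not (gray m s)
gray-step m s@(a , b) N = gray-odd-shift m s (step s N) (pos 1) refl (shift a b (pos m))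
  where
  shift : ∀ a b m → a ℤ.+ (b ℤ.+ pos 1) ℤ.+ m ≡ pos 1 ℤ.+ (a ℤ.+ b ℤ.+ m)
  shift = solveℤ
gray-step m s@(a , b) E = gray-odd-shift m s (step s E) (pos 1) refl (shift a b (pos m))
  where
  shift : ∀ a b m → a ℤ.+ pos 1 ℤ.+ b ℤ.+ m ≡ pos 1 ℤ.+ (a ℤ.+ b ℤ.+ m)
  shift = solveℤ
gray-step m s@(a , b) S = gray-odd-shift m s (step s S) (ℤ.- pos 1) refl (shift a b (pos m))
  where
  shift : ∀ a b m → a ℤ.+ (b ℤ.- pos 1) ℤ.+ m ≡ ℤ.- pos 1 ℤ.+ (a ℤ.+ b ℤ.+ m)
  shift = solveℤ
gray-step m s@(a , b) W = gray-odd-shift m s (step s W) (ℤ.- pos 1) refl (shift a b (pos m))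
  where
  shift : ∀ a b m → a ℤ.- pos 1 ℤ.+ b ℤ.+ m ≡ ℤ.- pos 1 ℤ.+ (a ℤ.+ b ℤ.+ m)
  shift = solveℤ

gray-swapSq : (m : ℕ) (s : Square) → gray m (swapSq s) ≡ gray m s
gray-swapSq m (a , b) = cong (λ x → ∣ x ℤ.+ pos m ∣ % 2 ≡ᵇ 0) (ℤₚ.+-comm b a)

-- The mirror image under x ↦ -x: the square [a,a+1]×[b,b+1] goes to [-a-1,-a]×[b,b+1].
reflectX : Square → Square
reflectX (a , b) = (ℤ.- (a ℤ.+ pos 1) , b)

reflectX-involutive : (s : Square) → reflectX (reflectX s) ≡ s
reflectX-involutive (a , b) = cong (_, b) (neg-neg a)
  where
  neg-neg : ∀ a → ℤ.- (ℤ.- (a ℤ.+ pos 1) ℤ.+ pos 1) ≡ a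
  neg-neg = solveℤ

gray-reflectX : (m : ℕ) (s : Square) → gray m (reflectX s) ≡ not (gray m s)
gray-reflectX m s@(a , b) = gray-odd-shift m s (reflectX s) δ δ-odd (shift a b (pos m))
  where
  δ : ℤ
  δ = ℤ.- pos 1 ℤ.+ ℤ.- (a ℤ.+ a)
  δ-odd : oddℤ δ ≡ true
  δ-odd = begin
    oddℤ δ                     ≡⟨ oddℤ-+ (ℤ.- pos 1) (ℤ.- (a ℤ.+ a)) ⟩
    not (oddℤ (ℤ.- (a ℤ.+ a))) ≡⟨ cong not (oddℤ-neg (a ℤ.+ a)) ⟩
    not (oddℤ (a ℤ.+ a))       ≡⟨ cong not (oddℤ-+ a a) ⟩
    not (oddℤ a xor oddℤ a)    ≡⟨ cong not (xor-same (oddℤ a)) ⟩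
    true                       ∎
    where open ≡-Reasoning
  shift : ∀ a b m → ℤ.- (a ℤ.+ pos 1) ℤ.+ b ℤ.+ m ≡ ℤ.- pos 1 ℤ.+ ℤ.- (a ℤ.+ a) ℤ.+ (a ℤ.+ b ℤ.+ m)
  shift = solveℤ

inDiamond-reflectX : (m : ℕ) (s : Square) → inDiamond m (reflectX s) ≡ inDiamond m s
inDiamond-reflectX m (a , b) = trans
  (cong₂ _∧_ (inRegion-neg (a ℤ.+ pos 1) b)
    (cong₂ _∧_ (inRegion-neg′ b)
      (cong₂ _∧_ (inRegion-neg (a ℤ.+ pos 1) (b ℤ.+ pos 1)) (inRegion-neg′ (b ℤ.+ pos 1)))))
  (∧-interchange (inRegion m a b) (inRegion m (a ℤ.+ pos 1) b)
                 (inRegion m a (b ℤ.+ pos 1)) (inRegion m (a ℤ.+ pos 1) (b ℤ.+ pos 1)))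
  where
  inRegion-neg : ∀ x y → inRegion m (ℤ.- x) y ≡ inRegion m x y
  inRegion-neg x y = cong (λ n → n + ∣ y ∣ ≤ᵇ suc m) (ℤₚ.∣-i∣≡∣i∣ x)
  neg-suc+1 : ∀ a → ℤ.- (a ℤ.+ pos 1) ℤ.+ pos 1 ≡ ℤ.- a
  neg-suc+1 = solveℤ
  inRegion-neg′ : ∀ y → inRegion m (ℤ.- (a ℤ.+ pos 1) ℤ.+ pos 1) y ≡ inRegion m a y
  inRegion-neg′ y = trans (cong (λ x → inRegion m x y) (neg-suc+1 a)) (inRegion-neg a y)
  ∧-interchange : ∀ p q r s → (q ∧ p ∧ s ∧ r) ≡ (p ∧ q ∧ r ∧ s)
  ∧-interchange true true r s = ∧-comm s r
  ∧-interchange true false r s = refl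
  ∧-interchange false true r s = refl
  ∧-interchange false false r s = refl

step-opp : (s : Square) (d : Dir) → step (step s d) (opp d) ≡ s
step-opp (a , b) N = cong (a ,_) (//-rightDividesʳ (pos 1) b)
step-opp (a , b) E = cong (_, b) (//-rightDividesʳ (pos 1) a)
step-opp (a , b) S = cong (a ,_) (//-rightDividesˡ (pos 1) b)
step-opp (a , b) W = cong (_, b) (//-rightDividesˡ (pos 1) a)

partner : {m : ℕ} → Tiling m → Square → Square
partner T s = step s (dir T s)

partner-involutive : {m : ℕ} (T : Tiling m) {s : Square} → InDiamond m s →
  partner T (partner T s) ≡ s
partner-involutive T {s} s∈◇ =
  trans (cong (step (partner T s)) (involutive T s s∈◇)) (step-opp s (dir T s))

module _ (m : ℕ) where

  private
    M : ℕ
    M = suc m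

  coord : ℕ → ℤ
  coord i = pos i ℤ.- pos M

  coords-unique : Unique (coords m)
  coords-unique = Unique.map⁺ (ℤₚ.+-injective ∘ +-cancelʳ (ℤ.- pos M) _ _) (Unique.upTo⁺ (2 * M))

  ∈-coords : ∀ {i} → i < M + M → coord i ∈ coords m
  ∈-coords {i} i<M+M =
    ∈-map⁺ coord (∈-upTo⁺ (subst (i <_) (cong (M +_) (sym (+-identityʳ M))) i<M+M))

  inRegion⇒∣x∣≤1+m : ∀ x y → inRegion m x y ≡ true → ∣ x ∣ ≤ M
  inRegion⇒∣x∣≤1+m x y x,y∈◇ = ≤-trans (m≤m+n ∣ x ∣ ∣ y ∣) (≤ᵇ⇒≤ _ _ (subst T (sym x,y∈◇) _))

  ∈-coords-inDiamond : ∀ a b → InDiamond m (a , b) → a ∈ coords m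
  ∈-coords-inDiamond (pos n) b a,b∈◇ =
    subst (_∈ coords m) (add-sub (pos M) (pos n)) (∈-coords (+-monoʳ-< M n<M))
    where
    add-sub : ∀ x y → x ℤ.+ y ℤ.- x ≡ y
    add-sub = solveℤ
    n<M : n < M
    n<M = subst (_≤ M) (+-comm n 1) (inRegion⇒∣x∣≤1+m (pos n ℤ.+ pos 1) b
      (∧-conicalˡ _ _ (∧-conicalʳ (inRegion m (pos n) b) _ a,b∈◇)))
  ∈-coords-inDiamond -[1+ n ] b a,b∈◇ =
    subst (_∈ coords m) coord≡a (∈-coords (≤-trans (s≤s (m∸n≤m m n)) (m≤m+n M M)))
    where
    sub-add : ∀ x y → x ℤ.- (x ℤ.+ y) ≡ ℤ.- y
    sub-add = solveℤ
    n<M : n < M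
    n<M = inRegion⇒∣x∣≤1+m -[1+ n ] b (∧-conicalˡ (inRegion m -[1+ n ] b) _ a,b∈◇)
    coord≡a : coord (M ∸ suc n) ≡ -[1+ n ]
    coord≡a = trans (cong (λ k → pos (M ∸ suc n) ℤ.- pos k) (sym (m∸n+n≡m n<M)))
                    (sub-add (pos (M ∸ suc n)) (pos (suc n)))

  private
    grid≡cartesianProduct : (xs ys : List ℤ) →
      concatMap (λ a → map (λ b → (a , b)) ys) xs ≡ cartesianProduct xs ys
    grid≡cartesianProduct [] ys = refl
    grid≡cartesianProduct (x ∷ xs) ys = cong (map (x ,_) ys ++_) (grid≡cartesianProduct xs ys)

    grid : List Square
    grid = concatMap (λ a → map (λ b → (a , b)) (coords m)) (coords m)

  diamondSquares-unique : Unique (diamondSquares m)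
  diamondSquares-unique = Unique.filter⁺ (λ s → inDiamond m s ≟ᵇ true)
    (subst Unique (sym (grid≡cartesianProduct (coords m) (coords m)))
      (Unique.cartesianProduct⁺ coords-unique coords-unique))

  ∈-diamondSquares⁺ : ∀ {s} → InDiamond m s → s ∈ diamondSquares m
  ∈-diamondSquares⁺ {a , b} s∈◇ = ∈-filter⁺ (λ s → inDiamond m s ≟ᵇ true) s∈grid s∈◇
    where
    s∈grid : (a , b) ∈ grid
    s∈grid = subst ((a , b) ∈_) (sym (grid≡cartesianProduct (coords m) (coords m)))
      (∈-cartesianProduct⁺ (∈-coords-inDiamond a b s∈◇)
        (∈-coords-inDiamond b a (trans (inDiamond-swap m (a , b)) s∈◇)))

  ∈-diamondSquares⁻ : ∀ {s} → s ∈ diamondSquares m → InDiamond m s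
  ∈-diamondSquares⁻ s∈ = proj₂ (∈-filter⁻ (λ s → inDiamond m s ≟ᵇ true) {xs = grid} s∈)

  -- grayCells m and whiteCells m are, definitionally, cellsWith (gray m) and cellsWith (white m).
  cellsWith : (Square → Bool) → List Square
  cellsWith P = filter (λ s → P s ≟ᵇ true) (diamondSquares m)

  cellsWith-unique : (P : Square → Bool) → Unique (cellsWith P)
  cellsWith-unique P = Unique.filter⁺ (λ s → P s ≟ᵇ true) diamondSquares-unique

  ∈-cellsWith⁺ : (P : Square → Bool) {s : Square} → InDiamond m s → P s ≡ true →
    s ∈ cellsWith P
  ∈-cellsWith⁺ P s∈◇ Ps = ∈-filter⁺ (λ s → P s ≟ᵇ true) (∈-diamondSquares⁺ s∈◇) Ps

  ∈-cellsWith⁻ : (P : Square → Bool) {s : Square} → s ∈ cellsWith P →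
    InDiamond m s × P s ≡ true
  ∈-cellsWith⁻ P s∈ with s∈◇ , Ps ← ∈-filter⁻ (λ s → P s ≟ᵇ true) {xs = diamondSquares m} s∈ =
    ∈-diamondSquares⁻ s∈◇ , Ps

  cellsWith-involution-↭ : (f : Square → Square) (P Q : Square → Bool) →
    (∀ {s} → InDiamond m s → InDiamond m (f s)) →
    (∀ {s} → InDiamond m s → f (f s) ≡ s) →
    (∀ {s} → InDiamond m s → Q (f s) ≡ P s) →
    map f (cellsWith P) ↭ cellsWith Q
  cellsWith-involution-↭ f P Q f-◇ ff≡id Qf≡P =
    map-↭-inverse (cellsWith-unique P) (cellsWith-unique Q) P→Q Q→P
      (ff≡id ∘ proj₁ ∘ ∈-cellsWith⁻ P) (ff≡id ∘ proj₁ ∘ ∈-cellsWith⁻ Q)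
    where
    P→Q : ∀ {s} → s ∈ cellsWith P → f s ∈ cellsWith Q
    P→Q s∈ with s∈◇ , Ps ← ∈-cellsWith⁻ P s∈ =
      ∈-cellsWith⁺ Q (f-◇ s∈◇) (trans (Qf≡P s∈◇) Ps)
    Q→P : ∀ {s} → s ∈ cellsWith Q → f s ∈ cellsWith P
    Q→P s∈ with s∈◇ , Qs ← ∈-cellsWith⁻ Q s∈ =
      ∈-cellsWith⁺ P (f-◇ s∈◇) (trans (sym (Qf≡P (f-◇ s∈◇))) (trans (cong Q (ff≡id s∈◇)) Qs))

  grayCells-swapSq-↭ : map swapSq (grayCells m) ↭ grayCells m
  grayCells-swapSq-↭ = cellsWith-involution-↭ swapSq (gray m) (gray m)
    (λ {s} → trans (inDiamond-swap m s)) (λ {s} _ → swapSq-inv s) (λ {s} _ → gray-swapSq m s)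

  whiteCells-swapSq-↭ : map swapSq (whiteCells m) ↭ whiteCells m
  whiteCells-swapSq-↭ = cellsWith-involution-↭ swapSq (white m) (white m)
    (λ {s} → trans (inDiamond-swap m s)) (λ {s} _ → swapSq-inv s)
    (λ {s} _ → cong not (gray-swapSq m s))

  grayCells-reflectX-↭ : map reflectX (grayCells m) ↭ whiteCells m
  grayCells-reflectX-↭ = cellsWith-involution-↭ reflectX (gray m) (white m)
    (λ {s} → trans (inDiamond-reflectX m s)) (λ {s} _ → reflectX-involutive s)
    (λ {s} _ → trans (cong not (gray-reflectX m s)) (not-involutive (gray m s)))

  grayCells-partner-↭ : (T : Tiling m) → map (partner T) (grayCells m) ↭ whiteCells m
  grayCells-partner-↭ T = cellsWith-involution-↭ (partner T) (gray m) (white m)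
    (inside T _) (partner-involutive T)
    (λ {s} _ → trans (cong not (gray-step m s (dir T s))) (not-involutive (gray m s)))

-- Counting the squares of the diamond

module _ (m : ℕ) where

  private
    M : ℕ
    M = suc m

  ∣coord∣-≤ : ∀ {i} → i ≤ M → ∣ coord m i ∣ ≡ M ∸ i
  ∣coord∣-≤ {i} i≤M = trans (cong ∣_∣ (ℤₚ.m-n≡m⊖n i M)) (ℤₚ.∣⊖∣-≤ i≤M)

  ∣coord∣-≥ : ∀ {i} → M ≤ i → ∣ coord m i ∣ ≡ i ∸ M
  ∣coord∣-≥ {i} M≤i = cong ∣_∣ (trans (ℤₚ.m-n≡m⊖n i M) (ℤₚ.⊖-≥ M≤i))

  coord-suc : ∀ i → coord m i ℤ.+ pos 1 ≡ coord m (suc i)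
  coord-suc i = shift (pos i) (pos M)
    where
    shift : ∀ x y → x ℤ.- y ℤ.+ pos 1 ≡ pos 1 ℤ.+ x ℤ.- y
    shift = solveℤ

  reach : ℕ → ℕ
  reach i = ∣ coord m i ∣ ⊔ ∣ coord m (suc i) ∣

  inDiamond-coord : ∀ i j → inDiamond m (coord m i , coord m j) ≡ (reach i + reach j ≤ᵇ M)
  inDiamond-coord i j rewrite coord-suc i | coord-suc j =
    sym (⊔+⊔-≤ᵇ (∣ coord m i ∣) (∣ coord m (suc i) ∣) (∣ coord m j ∣) (∣ coord m (suc j) ∣) M)

  reach-< : ∀ {i} → i < M → reach i ≡ suc (M ∸ suc i)
  reach-< {i} i<M = begin
    ∣ coord m i ∣ ⊔ ∣ coord m (suc i) ∣ ≡⟨ cong₂ _⊔_ (∣coord∣-≤ (<⇒≤ i<M)) (∣coord∣-≤ i<M) ⟩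
    (M ∸ i) ⊔ (M ∸ suc i)             ≡⟨ m≥n⇒m⊔n≡m (∸-monoʳ-≤ M (n≤1+n i)) ⟩
    M ∸ i                             ≡⟨ +-∸-assoc 1 i<M ⟩
    suc (M ∸ suc i)                   ∎
    where open ≡-Reasoning

  reach-M+ : ∀ l → reach (M + l) ≡ suc l
  reach-M+ l = begin
    ∣ coord m (M + l) ∣ ⊔ ∣ coord m (suc (M + l)) ∣
      ≡⟨ cong₂ _⊔_ (∣coord∣-≥ (m≤m+n M l)) (∣coord∣-≥ (m≤n⇒m≤1+n (m≤m+n M l))) ⟩
    (M + l ∸ M) ⊔ (suc (M + l) ∸ M)
      ≡⟨ cong₂ _⊔_ (m+n∸m≡n M l) (trans (cong (_∸ M) (sym (+-suc M l))) (m+n∸m≡n M (suc l))) ⟩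
    l ⊔ suc l
      ≡⟨ m≤n⇒m⊔n≡n (n≤1+n l) ⟩
    suc l
      ∎
    where open ≡-Reasoning

  Σ<-reach : (h : ℕ → ℕ) → Σ< (M + M) (h ∘ reach) ≡ Σ< M (h ∘ suc) + Σ< M (h ∘ suc)
  Σ<-reach h = begin
    Σ< (M + M) (h ∘ reach)                            ≡⟨ Σ<-++ M M (h ∘ reach) ⟩
    Σ< M (h ∘ reach) + Σ< M (λ l → h (reach (M + l))) ≡⟨ cong₂ _+_ left-half right-half ⟩
    Σ< M (h ∘ suc) + Σ< M (h ∘ suc)                   ∎
    where
    open ≡-Reasoning
    left-half : Σ< M (h ∘ reach) ≡ Σ< M (h ∘ suc)
    left-half = trans (Σ<-cong M (cong h ∘ reach-<)) (Σ<-reverse M (h ∘ suc))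
    right-half : Σ< M (λ l → h (reach (M + l))) ≡ Σ< M (h ∘ suc)
    right-half = Σ<-cong M (λ {l} _ → cong h (reach-M+ l))

  sum-map-coords : (F : ℤ → ℕ) → sum (map F (coords m)) ≡ Σ< (M + M) (F ∘ coord m)
  sum-map-coords F = begin
    sum (map F (coords m))                 ≡⟨ cong sum (map-∘ (upTo (2 * M))) ⟨
    sum (map (F ∘ coord m) (upTo (2 * M))) ≡⟨ sum-map-upTo (F ∘ coord m) (2 * M) ⟩
    Σ< (2 * M) (F ∘ coord m)               ≡⟨ cong (λ n → Σ< (M + n) (F ∘ coord m)) (+-identityʳ M) ⟩
    Σ< (M + M) (F ∘ coord m)               ∎
    where open ≡-Reasoning

  length-diamondSquares : length (diamondSquares m) ≡ 4 * (M C 2)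
  length-diamondSquares = begin
    length (diamondSquares m)                        ≡⟨ length-filter-true (inDiamond m) grid ⟩
    sum (map F grid)                                 ≡⟨ cong sum (map-concatMap F row (coords m)) ⟩
    sum (concatMap (map F ∘ row) (coords m))         ≡⟨ sum-concatMap (map F ∘ row) (coords m) ⟩
    sum (map (sum ∘ map F ∘ row) (coords m))         ≡⟨ sum-map-coords (sum ∘ map F ∘ row) ⟩
    Σ< (M + M) (λ i → sum (map F (row (coord m i)))) ≡⟨ Σ<-cong (M + M) (λ {i} _ → column i) ⟩
    Σ< (M + M) (λ i → (M ∸ reach i) + (M ∸ reach i)) ≡⟨ Σ<-reach (λ e → (M ∸ e) + (M ∸ e)) ⟩
    Σ< M (λ l → (M ∸ suc l) + (M ∸ suc l)) + Σ< M (λ l → (M ∸ suc l) + (M ∸ suc l))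
                                                     ≡⟨ cong₂ _+_ half half ⟩
    (M C 2 + M C 2) + (M C 2 + M C 2)                ≡⟨ quadruple (M C 2) ⟩
    4 * (M C 2)                                      ∎
    where
    open ≡-Reasoning
    F : Square → ℕ
    F = indicator ∘ inDiamond m
    row : ℤ → List Square
    row a = map (a ,_) (coords m)
    grid : List Square
    grid = concatMap row (coords m)
    count : ∀ i → Σ< M (λ l → indicator (reach i + suc l ≤ᵇ M)) ≡ M ∸ reach i
    count i = trans (Σ<-count-≤ M (reach i) M) (m≥n⇒m⊓n≡n (m∸n≤m M (reach i)))
    column : ∀ i → sum (map F (row (coord m i))) ≡ (M ∸ reach i) + (M ∸ reach i)
    column i = begin
      sum (map F (row (coord m i)))                         ≡⟨ cong sum (map-∘ (coords m)) ⟨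
      sum (map (λ b → F (coord m i , b)) (coords m))        ≡⟨ sum-map-coords (λ b → F (coord m i , b)) ⟩
      Σ< (M + M) (λ j → F (coord m i , coord m j))
        ≡⟨ Σ<-cong (M + M) (λ {j} _ → cong indicator (inDiamond-coord i j)) ⟩
      Σ< (M + M) (λ j → indicator (reach i + reach j ≤ᵇ M))
        ≡⟨ Σ<-reach (λ e → indicator (reach i + e ≤ᵇ M)) ⟩
      Σ< M (λ l → indicator (reach i + suc l ≤ᵇ M)) + Σ< M (λ l → indicator (reach i + suc l ≤ᵇ M))
        ≡⟨ cong₂ _+_ (count i) (count i) ⟩
      (M ∸ reach i) + (M ∸ reach i)                         ∎
    half : Σ< M (λ l → (M ∸ suc l) + (M ∸ suc l)) ≡ M C 2 + M C 2
    half = trans (Σ<-+ M _ _) (cong₂ _+_ (Σ<[n∸1+i]≡nC2 M) (Σ<[n∸1+i]≡nC2 M))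
    quadruple : ∀ x → (x + x) + (x + x) ≡ 4 * x
    quadruple = solve-∀

  length-grayCells : length (grayCells m) ≡ 2 * (M C 2)
  length-grayCells = *-cancelˡ-≡ (length G) (2 * (M C 2)) 2 (begin
    2 * length G                       ≡⟨ cong (length G +_) (+-identityʳ (length G)) ⟩
    length G + length G                ≡⟨ cong (length G +_) (length-map reflectX G) ⟨
    length G + length (map reflectX G) ≡⟨ cong (length G +_) (↭.↭-length (grayCells-reflectX-↭ m)) ⟩
    length G + length (whiteCells m)   ≡⟨ gray+white ⟩
    length D                           ≡⟨ length-diamondSquares ⟩
    4 * (M C 2)                        ≡⟨ *-assoc 2 2 (M C 2) ⟩
    2 * (2 * (M C 2))                  ∎)
    where
    open ≡-Reasoning
    G = grayCells m
    D = diamondSquares m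
    exactly-one : ∀ b → indicator b + indicator (not b) ≡ 1
    exactly-one true = refl
    exactly-one false = refl
    gray+white : length G + length (whiteCells m) ≡ length D
    gray+white = begin
      length G + length (whiteCells m)
        ≡⟨ cong₂ _+_ (length-filter-true (gray m) D) (length-filter-true (white m) D) ⟩
      sum (map (indicator ∘ gray m) D) + sum (map (indicator ∘ white m) D)
        ≡⟨ sum-map-+ (indicator ∘ gray m) (indicator ∘ white m) D ⟨
      sum (map (λ s → indicator (gray m s) + indicator (white m s)) D)
        ≡⟨ sum-map-cong D (λ {s} _ → exactly-one (gray m s)) ⟩
      sum (map (λ _ → 1) D)
        ≡⟨ sum-map-const 1 D ⟩
      length D * 1
        ≡⟨ *-identityʳ (length D) ⟩
      length D
        ∎

-- Directions of the dominoes on the gray squares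

_==_ : Dir → Dir → Bool
N == N = true
E == E = true
S == S = true
W == W = true
_ == _ = false

isNorthEast : Dir → Bool
isNorthEast N = true
isNorthEast E = true
isNorthEast _ = false

isSouthWest : Dir → Bool
isSouthWest S = true
isSouthWest W = true
isSouthWest _ = false

isNorthEast-opp : ∀ d → isNorthEast (opp d) ≡ isSouthWest d
isNorthEast-opp N = refl
isNorthEast-opp E = refl
isNorthEast-opp S = refl
isNorthEast-opp W = refl

module _ {m : ℕ} where

  dirCount : Tiling m → (Dir → Bool) → ℕ
  dirCount T P = sum (map (λ g → indicator (P (dir T g))) (grayCells m))

  dirCount-split : (T : Tiling m) (P Q R : Dir → Bool) →
    (∀ d → indicator (P d) ≡ indicator (Q d) + indicator (R d)) →
    dirCount T P ≡ dirCount T Q + dirCount T R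
  dirCount-split T P Q R P≡Q+R =
    trans (sum-map-cong (grayCells m) (λ {g} _ → P≡Q+R (dir T g))) (sum-map-+ _ _ (grayCells m))

  dirCount-cong : (T : Tiling m) {P Q : Dir → Bool} → (∀ d → P d ≡ Q d) →
    dirCount T P ≡ dirCount T Q
  dirCount-cong T P≗Q = sum-map-cong (grayCells m) (λ {g} _ → cong indicator (P≗Q (dir T g)))

  dirCount-reflectTiling : (T : Tiling m) (P : Dir → Bool) →
    dirCount (reflectTiling T) P ≡ dirCount T (P ∘ swapDir)
  dirCount-reflectTiling T P =
    sum-map-∘-↭ (λ g → indicator (P (swapDir (dir T g)))) (grayCells-swapSq-↭ m)

  dirCount-N≡S : (T : Tiling m) → dirCount T (_== N) ≡ dirCount T (_== S)
  dirCount-N≡S T = ℤₚ.+-injective (+-cancelˡ Y _ _ balance)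
    where
    G = grayCells m
    Y : ℤ
    Y = sumℤ (map proj₂ G)
    #[_] : Dir → Square → ℤ
    #[ d ] g = pos (indicator (dir T g == d))
    row-step : ∀ s d →
      proj₂ s ℤ.+ pos (indicator (d == N)) ≡ proj₂ (step s d) ℤ.+ pos (indicator (d == S))
    row-step (a , b) N = sym (ℤₚ.+-identityʳ (b ℤ.+ pos 1))
    row-step (a , b) E = refl
    row-step (a , b) S = trans (ℤₚ.+-identityʳ b) (sym (//-rightDividesˡ (pos 1) b))
    row-step (a , b) W = refl
    rows-partner : sumℤ (map (proj₂ ∘ partner T) G) ≡ Y
    rows-partner = trans (sumℤ-map-∘-↭ proj₂ (grayCells-partner-↭ m T))
                         (sym (sumℤ-map-∘-↭ proj₂ (grayCells-reflectX-↭ m)))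
    balance : Y ℤ.+ pos (dirCount T (_== N)) ≡ Y ℤ.+ pos (dirCount T (_== S))
    balance = begin
      Y ℤ.+ pos (dirCount T (_== N))
        ≡⟨ cong (λ t → Y ℤ.+ t) (sumℤ-map-pos _ G) ⟨
      Y ℤ.+ sumℤ (map #[ N ] G)
        ≡⟨ sumℤ-map-+ proj₂ #[ N ] G ⟨
      sumℤ (map (λ g → proj₂ g ℤ.+ #[ N ] g) G)
        ≡⟨ cong sumℤ (map-cong (λ g → row-step g (dir T g)) G) ⟩
      sumℤ (map (λ g → proj₂ (partner T g) ℤ.+ #[ S ] g) G)
        ≡⟨ sumℤ-map-+ (proj₂ ∘ partner T) #[ S ] G ⟩
      sumℤ (map (proj₂ ∘ partner T) G) ℤ.+ sumℤ (map #[ S ] G)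
        ≡⟨ cong₂ ℤ._+_ rows-partner (sumℤ-map-pos _ G) ⟩
      Y ℤ.+ pos (dirCount T (_== S))
        ∎
      where open ≡-Reasoning

  dirCount-E≡W : (T : Tiling m) → dirCount T (_== E) ≡ dirCount T (_== W)
  dirCount-E≡W T = begin
    dirCount T (_== E)                  ≡⟨ dirCount-cong T ==E ⟩
    dirCount T ((_== N) ∘ swapDir)      ≡⟨ dirCount-reflectTiling T (_== N) ⟨
    dirCount (reflectTiling T) (_== N)  ≡⟨ dirCount-N≡S (reflectTiling T) ⟩
    dirCount (reflectTiling T) (_== S)  ≡⟨ dirCount-reflectTiling T (_== S) ⟩
    dirCount T ((_== S) ∘ swapDir)      ≡⟨ dirCount-cong T ==W ⟩
    dirCount T (_== W)                  ∎
    where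
    open ≡-Reasoning
    ==E : ∀ d → (d == E) ≡ (swapDir d == N)
    ==E N = refl
    ==E E = refl
    ==E S = refl
    ==E W = refl
    ==W : ∀ d → (swapDir d == S) ≡ (d == W)
    ==W N = refl
    ==W E = refl
    ==W S = refl
    ==W W = refl

  southWestCount : (T : Tiling m) → dirCount T isSouthWest ≡ suc m C 2
  southWestCount T = *-cancelˡ-≡ SW (suc m C 2) 2 (begin
    2 * SW                      ≡⟨ cong (SW +_) (+-identityʳ SW) ⟩
    SW + SW                     ≡⟨ cong (_+ SW) northEast≡southWest ⟨
    dirCount T isNorthEast + SW ≡⟨ dirCount-split T (λ _ → true) isNorthEast isSouthWest one ⟨
    dirCount T (λ _ → true)     ≡⟨ sum-map-const 1 (grayCells m) ⟩
    length (grayCells m) * 1    ≡⟨ *-identityʳ (length (grayCells m)) ⟩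
    length (grayCells m)        ≡⟨ length-grayCells m ⟩
    2 * (suc m C 2)             ∎)
    where
    open ≡-Reasoning
    SW = dirCount T isSouthWest
    one : ∀ d → 1 ≡ indicator (isNorthEast d) + indicator (isSouthWest d)
    one = λ { N → refl ; E → refl ; S → refl ; W → refl }
    NE-split : ∀ d → indicator (isNorthEast d) ≡ indicator (d == N) + indicator (d == E)
    NE-split = λ { N → refl ; E → refl ; S → refl ; W → refl }
    SW-split : ∀ d → indicator (isSouthWest d) ≡ indicator (d == S) + indicator (d == W)
    SW-split = λ { N → refl ; E → refl ; S → refl ; W → refl }
    northEast≡southWest : dirCount T isNorthEast ≡ SW
    northEast≡southWest = begin
      dirCount T isNorthEast                  ≡⟨ dirCount-split T isNorthEast (_== N) (_== E) NE-split ⟩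
      dirCount T (_== N) + dirCount T (_== E) ≡⟨ cong₂ _+_ (dirCount-N≡S T) (dirCount-E≡W T) ⟩
      dirCount T (_== S) + dirCount T (_== W) ≡⟨ dirCount-split T isSouthWest (_== S) (_== W) SW-split ⟨
      SW                                      ∎

-- Interactions

length-colourPairs : (k : ℕ) → length (colourPairs k) ≡ k C 2
length-colourPairs k = begin
  length (colourPairs k)                         ≡⟨ length-filter-true F pairs ⟩
  sum (map χ pairs)                              ≡⟨ cong sum (map-concatMap χ row (allFin k)) ⟩
  sum (concatMap (map χ ∘ row) (allFin k))       ≡⟨ sum-concatMap (map χ ∘ row) (allFin k) ⟩
  sum (map (sum ∘ map χ ∘ row) (allFin k))       ≡⟨ sum-map-cong (allFin k) (λ {α} _ → later-colours α) ⟩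
  sum (map ((λ a → k ∸ suc a) ∘ toℕ) (allFin k)) ≡⟨ sum-map-allFin (λ a → k ∸ suc a) k ⟩
  Σ< k (λ a → k ∸ suc a)                         ≡⟨ Σ<[n∸1+i]≡nC2 k ⟩
  k C 2                                          ∎
  where
  open ≡-Reasoning
  F : Fin k × Fin k → Bool
  F (α , β) = toℕ α <ᵇ toℕ β
  χ : Fin k × Fin k → ℕ
  χ = indicator ∘ F
  row : Fin k → List (Fin k × Fin k)
  row α = map (α ,_) (allFin k)
  pairs : List (Fin k × Fin k)
  pairs = concatMap row (allFin k)
  later-colours : ∀ α → sum (map χ (row α)) ≡ k ∸ suc (toℕ α)
  later-colours α = begin
    sum (map χ (row α))
      ≡⟨ cong sum (map-∘ (allFin k)) ⟨
    sum (map ((λ b → indicator (toℕ α <ᵇ b)) ∘ toℕ) (allFin k))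
      ≡⟨ sum-map-allFin (λ b → indicator (toℕ α <ᵇ b)) k ⟩
    Σ< k (λ b → indicator (toℕ α <ᵇ b))
      ≡⟨ Σ<-count-< (toℕ α) k ⟩
    k ∸ suc (toℕ α)
      ∎

pairInteractions : {m : ℕ} → (Dir → Dir → Bool) → List Square → Tiling m → Tiling m → ℕ
pairInteractions R cells Tα Tβ = sum (map (λ s → indicator (R (dir Tα s) (dir Tβ s))) cells)

-- interactions₁ = interactionsWith rel₁ (grayCells m), interactions₂ = interactionsWith rel₂ (whiteCells m).
interactionsWith : {k m : ℕ} → (Dir → Dir → Bool) → List Square → KTiling k m → ℕ
interactionsWith {k} R cells T = sum (concatMap
  (λ p → map (λ s → indicator (R (dir (T (proj₁ p)) s) (dir (T (proj₂ p)) s))) cells)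
  (colourPairs k))

interactionsWith-φ : {k m : ℕ} (R : Dir → Dir → Bool) (cells : List Square) (c : ℕ) →
  ((Tα Tβ : Tiling m) →
    pairInteractions R cells (reflectTiling Tα) (reflectTiling Tβ) + pairInteractions R cells Tα Tβ ≡ c) →
  (T : KTiling k m) → interactionsWith R cells (φ T) + interactionsWith R cells T ≡ (k C 2) * c
interactionsWith-φ {k} R cells c pair≡c T = begin
  interactionsWith R cells (φ T) + interactionsWith R cells T
    ≡⟨ cong₂ _+_ (sum-concatMap (λ p → map (f (φ T) p) cells) CP)
                 (sum-concatMap (λ p → map (f T p) cells) CP) ⟩
  sum (map (I (φ T)) CP) + sum (map (I T) CP) ≡⟨ sum-map-+ (I (φ T)) (I T) CP ⟨
  sum (map (λ p → I (φ T) p + I T p) CP)      ≡⟨ sum-map-cong CP (λ {(α , β)} _ → pair≡c (T α) (T β)) ⟩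
  sum (map (λ _ → c) CP)                      ≡⟨ sum-map-const c CP ⟩
  length CP * c                               ≡⟨ cong (_* c) (length-colourPairs k) ⟩
  (k C 2) * c                                 ∎
  where
  open ≡-Reasoning
  CP = colourPairs k
  f : KTiling k _ → Fin k × Fin k → Square → ℕ
  f T (α , β) s = indicator (R (dir (T α) s) (dir (T β) s))
  I : KTiling k _ → Fin k × Fin k → ℕ
  I T (α , β) = pairInteractions R cells (T α) (T β)

pairInteractions-reflectTiling : {m : ℕ} (R : Dir → Dir → Bool) {cells : List Square} →
  map swapSq cells ↭ cells → (Tα Tβ : Tiling m) →
  pairInteractions R cells (reflectTiling Tα) (reflectTiling Tβ) + pairInteractions R cells Tα Tβ
    ≡ sum (map (λ s → indicator (R (swapDir (dir Tα s)) (swapDir (dir Tβ s)))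
                    + indicator (R (dir Tα s) (dir Tβ s))) cells)
pairInteractions-reflectTiling R {cells} swap↭ Tα Tβ = trans
  (cong (_+ pairInteractions R cells Tα Tβ)
    (sum-map-∘-↭ (λ s → indicator (R (swapDir (dir Tα s)) (swapDir (dir Tβ s)))) swap↭))
  (sym (sum-map-+ _ _ cells))

rel₁-swapDir : ∀ x y →
  indicator (rel₁ (swapDir x) (swapDir y)) + indicator (rel₁ x y) ≡ indicator (isSouthWest y)
rel₁-swapDir N N = refl
rel₁-swapDir N E = refl
rel₁-swapDir N S = refl
rel₁-swapDir N W = refl
rel₁-swapDir E N = refl
rel₁-swapDir E E = refl
rel₁-swapDir E S = refl
rel₁-swapDir E W = refl
rel₁-swapDir S N = refl
rel₁-swapDir S E = refl
rel₁-swapDir S S = refl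
rel₁-swapDir S W = refl
rel₁-swapDir W N = refl
rel₁-swapDir W E = refl
rel₁-swapDir W S = refl
rel₁-swapDir W W = refl

rel₂-swapDir : ∀ x y →
  indicator (rel₂ (swapDir x) (swapDir y)) + indicator (rel₂ x y) ≡ indicator (isNorthEast x)
rel₂-swapDir N N = refl
rel₂-swapDir N E = refl
rel₂-swapDir N S = refl
rel₂-swapDir N W = refl
rel₂-swapDir E N = refl
rel₂-swapDir E E = refl
rel₂-swapDir E S = refl
rel₂-swapDir E W = refl
rel₂-swapDir S N = refl
rel₂-swapDir S E = refl
rel₂-swapDir S S = refl
rel₂-swapDir S W = refl
rel₂-swapDir W N = refl
rel₂-swapDir W E = refl
rel₂-swapDir W S = refl
rel₂-swapDir W W = refl

module _ {m : ℕ} (Tα Tβ : Tiling m) where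

  pairInteractions₁-reflectTiling :
    pairInteractions rel₁ (grayCells m) (reflectTiling Tα) (reflectTiling Tβ)
      + pairInteractions rel₁ (grayCells m) Tα Tβ ≡ suc m C 2
  pairInteractions₁-reflectTiling = begin
    _ ≡⟨ pairInteractions-reflectTiling rel₁ (grayCells-swapSq-↭ m) Tα Tβ ⟩
    _ ≡⟨ sum-map-cong (grayCells m) (λ {g} _ → rel₁-swapDir (dir Tα g) (dir Tβ g)) ⟩
    dirCount Tβ isSouthWest
      ≡⟨ southWestCount Tβ ⟩
    suc m C 2
      ∎
    where open ≡-Reasoning

  pairInteractions₂-reflectTiling :
    pairInteractions rel₂ (whiteCells m) (reflectTiling Tα) (reflectTiling Tβ)
      + pairInteractions rel₂ (whiteCells m) Tα Tβ ≡ suc m C 2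
  pairInteractions₂-reflectTiling = begin
    _ ≡⟨ pairInteractions-reflectTiling rel₂ (whiteCells-swapSq-↭ m) Tα Tβ ⟩
    _ ≡⟨ sum-map-cong (whiteCells m) (λ {w} _ → rel₂-swapDir (dir Tα w) (dir Tβ w)) ⟩
    sum (map (λ w → indicator (isNorthEast (dir Tα w))) (whiteCells m))
      ≡⟨ sum-map-∘-↭ (λ w → indicator (isNorthEast (dir Tα w))) (grayCells-partner-↭ m Tα) ⟨
    sum (map (λ g → indicator (isNorthEast (dir Tα (partner Tα g)))) (grayCells m))
      ≡⟨ sum-map-cong (grayCells m) (λ {g} g∈ → cong indicator (partner-dir g∈)) ⟩
    dirCount Tα isSouthWest
      ≡⟨ southWestCount Tα ⟩
    suc m C 2
      ∎
    where
    open ≡-Reasoning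
    partner-dir : ∀ {g} → g ∈ grayCells m →
      isNorthEast (dir Tα (partner Tα g)) ≡ isSouthWest (dir Tα g)
    partner-dir {g} g∈ =
      trans (cong isNorthEast (involutive Tα g (proj₁ (∈-cellsWith⁻ m (gray m) g∈))))
            (isNorthEast-opp (dir Tα g))

mainTheorem7 : (k m : ℕ) → 1 ≤ k → 1 ≤ m → (T : KTiling k m) → (j : ℕ) →
    (interactions₁ T ≡ j → interactions₁ (φ T) + j ≡ (k C 2) * ((m + 1) C 2))
    × (interactions₂ T ≡ j → interactions₂ (φ T) + j ≡ (k C 2) * ((m + 1) C 2))
mainTheorem7 k m _ _ T j = notion₁ , notion₂
  where
  m+1≡suc : (k C 2) * (suc m C 2) ≡ (k C 2) * ((m + 1) C 2)
  m+1≡suc = cong (λ n → (k C 2) * (n C 2)) (+-comm 1 m)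
  notion₁ : interactions₁ T ≡ j → interactions₁ (φ T) + j ≡ (k C 2) * ((m + 1) C 2)
  notion₁ refl =
    trans (interactionsWith-φ rel₁ (grayCells m) _ pairInteractions₁-reflectTiling T) m+1≡suc
  notion₂ : interactions₂ T ≡ j → interactions₂ (φ T) + j ≡ (k C 2) * ((m + 1) C 2)
  notion₂ refl =
    trans (interactionsWith-φ rel₂ (whiteCells m) _ pairInteractions₂-reflectTiling T) m+1≡suc
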